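{- For $w\in W$, the coweight $\delta_w$ is the unique $\lambda\in\Lambda^\vee$ such that $w^{ -1}(A_\circ)+\lambda\subset\Pi$.
   Context: Root system data. - $\Phi$ is an irreducible crystallographic root system spanning a real Euclidean space $V$ of dimension $r$, with simple roots $\alpha_1,\dots,\alpha_r$ and positive roots $\Phi^+$. Write $\alpha<0$ if $-\alpha\in\Phi^+$. - $W$ is the Weyl group. - $\Lambda^\vee=\{\lambda:(\lambda,\alpha)\in\mathbb{Z}\ \forall\alpha\in\Phi\}$ is the coweight lattice. - $\omega_i$ are the fundamental coweights, $(\omega_i,\alpha_j)=\delta_{ij}$. Definitions. - $A_\circ=\{\lambda:0<(\lambda,\alpha)<1\ \forall\alpha\in\Phi^+\}$ is the fundamental alcove. - $\Pi=\{\lambda\in V:0\le(\lambda,\alpha_i)\le1,\ i=1,\dots,r\}$. - For $1\le i\le r$, $d_i(w)=1$ if $w(\alpha_i)<0$ and $0$ otherwise. - $\delta_w=\sum_{i=1}^rd_i(w)\omega_i$.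
   Formalization: The space V is ℚ^r with a rational inner product rather than a real Euclidean space, so the points of $A_\circ$ and the coweights λ have rational coordinates. -}

module Defs where

open import Data.Nat using (ℕ; zero; suc)
open import Data.Integer using (ℤ; +_)
open import Data.Fin using (Fin; zero; suc)
open import Data.Bool using (Bool; true; false)
open import Data.List using (List; []; _∷_; reverse)
open import Data.Product using (Σ; ∃; _×_; _,_)
open import Data.Sum using (_⊎_)
open import Function.Definitions using (Injective)
open import Relation.Binary.PropositionalEquality using (_≡_; _≢_)
open import Relation.Nullary using (¬_; yes; no)
open import Data.Rational using (ℚ; 0ℚ; 1ℚ; _+_; _*_; _-_; -_; _<_; _≤_; _/_; 1/_; ≢-nonZero)
open import Data.Rational.Properties using (_≟_)

Vect : ℕ → Set
Vect n = Fin n → ℚ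

sumF : ∀ {n} → (Fin n → ℚ) → ℚ
sumF {zero}  f = 0ℚ
sumF {suc n} f = f zero + sumF {n} (λ i → f (suc i))

zeroV : ∀ {n} → Vect n
zeroV _ = 0ℚ

_⊕_ : ∀ {n} → Vect n → Vect n → Vect n
(u ⊕ v) i = u i + v i

_•_ : ∀ {n} → ℚ → Vect n → Vect n
(c • v) i = c * v i

⊖_ : ∀ {n} → Vect n → Vect n
(⊖ v) i = - v i

lincomb : ∀ {n k} → (Fin k → ℚ) → (Fin k → Vect n) → Vect n
lincomb c v j = sumF (λ i → c i * v i j)

_≐_ : ∀ {n} → Vect n → Vect n → Set
u ≐ v = ∀ i → u i ≡ v i

IsInt : ℚ → Set
IsInt q = Σ ℤ λ k → q ≡ k / 1

-- total inverse (1/0 := 0); only used at nonzero arguments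
inv : ℚ → ℚ
inv q with q ≟ 0ℚ
... | yes _ = 0ℚ
... | no q≢0 = 1/_ q {{≢-nonZero q≢0}}

record Euclidean (n : ℕ) : Set where
  field
    G       : Fin n → Fin n → ℚ
    G-sym   : ∀ i j → G i j ≡ G j i
  ⟪_,_⟫ : Vect n → Vect n → ℚ
  ⟪ u , v ⟫ = sumF (λ i → sumF (λ j → u i * G i j * v j))
  field
    G-posdef : ∀ (v : Vect n) → ¬ (v ≐ zeroV) → 0ℚ < ⟪ v , v ⟫

  reflect : Vect n → Vect n → Vect n
  reflect α v = v ⊕ (⊖ (((1ℚ + 1ℚ) * ⟪ v , α ⟫ * inv ⟪ α , α ⟫) • α))

record RootSystem (r : ℕ) : Set where
  field
    E       : Euclidean r
  open Euclidean E public
  field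
    m        : ℕ
    root     : Fin m → Vect r
    root-inj : ∀ a b → root a ≐ root b → a ≡ b
    root≢0   : ∀ a → ¬ (root a ≐ zeroV)
    spans    : ∀ (v : Vect r) → Σ (Fin m → ℚ) λ c → v ≐ lincomb c root
    refl-closed : ∀ a b → Σ (Fin m) λ c → root c ≐ reflect (root a) (root b)
    reduced  : ∀ a b (c : ℚ) → root b ≐ (c • root a) → (c ≡ 1ℚ) ⊎ (c ≡ - 1ℚ)
    crystallographic : ∀ a b → IsInt ((1ℚ + 1ℚ) * ⟪ root b , root a ⟫ * inv ⟪ root a , root a ⟫)
    irreducible : ∀ (P : Fin m → Bool) →
                  (∀ a b → P a ≡ true → P b ≡ false → ⟪ root a , root b ⟫ ≡ 0ℚ) →
                  (∀ a → P a ≡ true) ⊎ (∀ a → P a ≡ false)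
    simple   : Fin r → Fin m
    base     : ∀ a → Σ (Fin r → ℕ) λ c →
                 (root a ≐ lincomb (λ i → + c i / 1) (λ i → root (simple i)))
                 ⊎ (root a ≐ (⊖ lincomb (λ i → + c i / 1) (λ i → root (simple i))))

  α : Fin r → Vect r
  α i = root (simple i)

  Positive : Vect r → Set
  Positive v = Σ (Fin m) λ a → (root a ≐ v) × Σ (Fin r → ℕ) λ c → v ≐ lincomb (λ i → + c i / 1) α

  Negative : Vect r → Set
  Negative v = Positive (⊖ v)

  -- Weyl group W: generated by the reflections s_α (α ∈ Φ); an element is
  -- represented by a word in these reflections, acting on V
  Word : Set
  Word = List (Fin m)

  act : Word → Vect r → Vect r
  act []      v = v
  act (a ∷ w) v = reflect (root a) (act w v)

  -- action of w⁻¹ (the reflections are involutions)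
  actInv : Word → Vect r → Vect r
  actInv w = act (reverse w)

  Coweight : Vect r → Set
  Coweight λ' = ∀ a → IsInt ⟪ λ' , root a ⟫

  InAlcove : Vect r → Set
  InAlcove μ = ∀ a → Positive (root a) → (0ℚ < ⟪ μ , root a ⟫) × (⟪ μ , root a ⟫ < 1ℚ)

  InΠ : Vect r → Set
  InΠ v = ∀ i → (0ℚ ≤ ⟪ v , α i ⟫) × (⟪ v , α i ⟫ ≤ 1ℚ)

  Translate⊆Π : Word → Vect r → Set
  Translate⊆Π w λ' = ∀ μ → InAlcove μ → InΠ (actInv w μ ⊕ λ')

  IsFundCoweights : (Fin r → Vect r) → Set
  IsFundCoweights ω = ∀ i j → (i ≡ j → ⟪ ω i , α j ⟫ ≡ 1ℚ) × (i ≢ j → ⟪ ω i , α j ⟫ ≡ 0ℚ)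

  IsDescent : Word → (Fin r → ℚ) → Set
  IsDescent w d = ∀ i → ((d i ≡ 1ℚ) × Negative (act w (α i)))
                        ⊎ ((d i ≡ 0ℚ) × ¬ Negative (act w (α i)))

  delta : (Fin r → ℚ) → (Fin r → Vect r) → Vect r
  delta d ω = lincomb d ω

module Submission where

-- Since w is orthogonal, ⟪w⁻¹μ + λ , α_i⟫ = ⟪μ , w α_i⟫ + ⟪λ , α_i⟫.
-- For μ ∈ A∘ the root w α_i is positive or negative, so x = ⟪μ , w α_i⟫ lies
-- in (0,1) or in (-1,0), and in both cases  0 < x + d_i(w) < 1  (the descent
-- window).  Existence: ⟪δ_w , α_i⟫ = d_i(w), so the pairing above lies in
-- (0,1) ⊆ [0,1]; δ_w is a coweight because every root is an integral
-- combination of simple roots.  Uniqueness: fix one μ₀ ∈ A∘ (a small multiple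
-- of ρ = Σ ω_i).  If λ is a coweight with w⁻¹(A∘) + λ ⊆ Π, then the integer
-- ⟪λ , α_i⟫ - d_i(w) is a difference of a number in [0,1] and a number in
-- (0,1), hence 0; so λ - δ_w is orthogonal to all simple roots, hence to all
-- of V, hence zero.

open import Defs
open import Data.Nat using (ℕ)
open import Data.Fin using (Fin)
open import Data.Product using (_×_)
open import Data.Rational using (ℚ)

open import Data.Nat as N using (zero; suc)
open import Data.Integer as Z using (ℤ; +0; -[1+_])
import Data.Integer.Properties as ZP
import Data.Nat.Properties as NP
open import Data.Fin using (zero; suc)
open import Data.Fin.Properties using (suc-injective; any?; all?)
open import Data.List using ([]; _∷_; reverse; _++_)
open import Data.List.Properties using (unfold-reverse)
open import Data.Product using (Σ; _,_; proj₁; proj₂)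
open import Data.Sum using (_⊎_; inj₁; inj₂)
open import Data.Empty using (⊥-elim)
open import Function using (_∘_)
open import Relation.Nullary using (¬_; yes; no)
open import Relation.Binary.PropositionalEquality
open import Data.Rational as Q
  using (0ℚ; 1ℚ; _+_; _*_; _-_; -_; _<_; _≤_; _/_; 1/_; ∣_∣; *<*; *≤*; ≢-nonZero)
open import Data.Rational.Properties
open import Algebra.Properties.Group +-0-group using (⁻¹-involutive)
open import Data.Rational.Literals using (fromℤ)
open import Data.Rational.Solver using (module +-*-Solver)
open +-*-Solver using (solve; con; _:+_; _:*_; :-_; _:=_)

sumF-cong : ∀ {n} {f g : Fin n → ℚ} → (∀ i → f i ≡ g i) → sumF f ≡ sumF g
sumF-cong {zero}  h = refl
sumF-cong {suc n} h = cong₂ _+_ (h zero) (sumF-cong (λ i → h (suc i)))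

sumF-zero : ∀ {n} → sumF {n} (λ _ → 0ℚ) ≡ 0ℚ
sumF-zero {zero}  = refl
sumF-zero {suc n} = trans (+-identityˡ _) (sumF-zero {n})

sumF-vanish : ∀ {n} (f : Fin n → ℚ) → (∀ i → f i ≡ 0ℚ) → sumF f ≡ 0ℚ
sumF-vanish {n} f h = trans (sumF-cong h) (sumF-zero {n})

sumF-+ : ∀ {n} (f g : Fin n → ℚ) → sumF (λ i → f i + g i) ≡ sumF f + sumF g
sumF-+ {zero}  f g = sym (+-identityˡ 0ℚ)
sumF-+ {suc n} f g =
  trans (cong ((f zero + g zero) +_) (sumF-+ (λ i → f (suc i)) (λ i → g (suc i))))
        (solve 4 (λ a b c d → (a :+ b) :+ (c :+ d) := (a :+ c) :+ (b :+ d)) refl (f zero) (g zero) _ _)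

sumF-* : ∀ {n} (c : ℚ) (f : Fin n → ℚ) → sumF (λ i → c * f i) ≡ c * sumF f
sumF-* {zero}  c f = sym (*-zeroʳ c)
sumF-* {suc n} c f =
  trans (cong (c * f zero +_) (sumF-* c (λ i → f (suc i)))) (sym (*-distribˡ-+ c (f zero) _))

sumF-swap : ∀ {n k} (f : Fin n → Fin k → ℚ) →
            sumF (λ i → sumF (λ j → f i j)) ≡ sumF (λ j → sumF (λ i → f i j))
sumF-swap {zero}  {k} f = sym (sumF-zero {k})
sumF-swap {suc n}     f =
  trans (cong (sumF (f zero) +_) (sumF-swap (λ i → f (suc i))))
        (sym (sumF-+ (f zero) (λ j → sumF (λ i → f (suc i) j))))

sumF-single : ∀ {n} (f : Fin n → ℚ) (i : Fin n) → (∀ j → j ≢ i → f j ≡ 0ℚ) → sumF f ≡ f i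
sumF-single {suc n} f zero h =
  trans (cong (f zero +_) (sumF-vanish _ (λ j → h (suc j) (λ ())))) (+-identityʳ (f zero))
sumF-single {suc n} f (suc i) h =
  trans (cong₂ _+_ (h zero (λ ())) (sumF-single (λ j → f (suc j)) i (λ j j≢i → h (suc j) (j≢i ∘ suc-injective))))
        (+-identityˡ (f (suc i)))

sumF-nonneg : ∀ {n} (f : Fin n → ℚ) → (∀ j → 0ℚ ≤ f j) → 0ℚ ≤ sumF f
sumF-nonneg {zero}  f h = ≤-refl
sumF-nonneg {suc n} f h =
  subst (_≤ sumF f) (+-identityˡ 0ℚ) (+-mono-≤ (h zero) (sumF-nonneg (λ j → f (suc j)) (λ j → h (suc j))))

sumF-term : ∀ {n} (f : Fin n → ℚ) → (∀ j → 0ℚ ≤ f j) → ∀ i → f i ≤ sumF f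
sumF-term {suc n} f h zero =
  subst (_≤ sumF f) (+-identityʳ (f zero)) (+-monoʳ-≤ (f zero) (sumF-nonneg (λ j → f (suc j)) (λ j → h (suc j))))
sumF-term {suc n} f h (suc i) =
  subst (_≤ sumF f) (+-identityˡ (f (suc i))) (+-mono-≤ (h zero) (sumF-term (λ j → f (suc j)) (λ j → h (suc j)) i))

0<1 : 0ℚ < 1ℚ
0<1 = *<* (Z.+<+ (N.s≤s N.z≤n))

OpenUnit ClosedUnit OpenInterval : ℚ → Set
OpenUnit     t = (0ℚ < t) × (t < 1ℚ)
ClosedUnit   t = (0ℚ ≤ t) × (t ≤ 1ℚ)
OpenInterval t = (- 1ℚ < t) × (t < 1ℚ)

-- q is the image of an integer (equivalent to Defs' IsInt, but stated
-- with fromℤ, which computes well with _+_ and _*_)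
Integral : ℚ → Set
Integral q = Σ ℤ λ k → q ≡ fromℤ k

/1≡fromℤ : ∀ k → k / 1 ≡ fromℤ k
/1≡fromℤ k = ↥p/↧p≡p (fromℤ k)

IsInt⇒Integral : ∀ {q} → IsInt q → Integral q
IsInt⇒Integral (k , e) = k , trans e (/1≡fromℤ k)

Integral⇒IsInt : ∀ {q} → Integral q → IsInt q
Integral⇒IsInt (k , e) = k , trans e (sym (/1≡fromℤ k))

integral-ℕ : ∀ n → Integral (Z.+ n / 1)
integral-ℕ n = Z.+ n , /1≡fromℤ (Z.+ n)

integral-+ : ∀ {p q} → Integral p → Integral q → Integral (p + q)
integral-+ (a , refl) (b , refl) =
  a Z.+ b , trans (cong₂ (λ x y → (x Z.+ y) / 1) (ZP.*-identityʳ a) (ZP.*-identityʳ b)) (/1≡fromℤ (a Z.+ b))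

integral-neg : ∀ {p} → Integral p → Integral (- p)
integral-neg (+0          , refl) = +0 , refl
integral-neg (Z.+[1+ n ] , refl) = -[1+ n ] , refl
integral-neg (-[1+ n ]   , refl) = Z.+[1+ n ] , refl

integral-* : ∀ {p q} → Integral p → Integral q → Integral (p * q)
integral-* (a , refl) (b , refl) = a Z.* b , /1≡fromℤ (a Z.* b)

integral-sumF : ∀ {n} (f : Fin n → ℚ) → (∀ i → Integral (f i)) → Integral (sumF f)
integral-sumF {zero}  f h = +0 , refl
integral-sumF {suc n} f h = integral-+ (h zero) (integral-sumF (λ i → f (suc i)) (λ i → h (suc i)))

fromℤ-cancel-< : ∀ a b → fromℤ a < fromℤ b → a Z.< b
fromℤ-cancel-< a b (*<* p) = subst₂ Z._<_ (ZP.*-identityʳ a) (ZP.*-identityʳ b) p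

fromℤ-mono-≤ : ∀ {a b} → a Z.≤ b → fromℤ a ≤ fromℤ b
fromℤ-mono-≤ {a} {b} p = *≤* (subst₂ Z._≤_ (sym (ZP.*-identityʳ a)) (sym (ZP.*-identityʳ b)) p)

integral-between : ∀ {q} → Integral q → OpenInterval q → q ≡ 0ℚ
integral-between (k , refl) (p , q) with fromℤ-cancel-< -[1+ 0 ] k p | fromℤ-cancel-< k (Z.+ 1) q
... | Z.-<- () | _
... | Z.-<+    | Z.+<+ (N.s≤s N.z≤n) = refl

0≤ℕ : ∀ n → 0ℚ ≤ Z.+ n / 1
0≤ℕ n = subst (0ℚ ≤_) (sym (/1≡fromℤ (Z.+ n))) (fromℤ-mono-≤ (Z.+≤+ N.z≤n))

1≤ℕ : ∀ n → 1 N.≤ n → 1ℚ ≤ Z.+ n / 1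
1≤ℕ n 1≤n = subst (1ℚ ≤_) (sym (/1≡fromℤ (Z.+ n))) (fromℤ-mono-≤ (Z.+≤+ 1≤n))

open⊆closed : ∀ {t} → OpenUnit t → ClosedUnit t
open⊆closed (0<t , t<1) = <⇒≤ 0<t , <⇒≤ t<1

shift-by-one : ∀ x → OpenUnit (- x) → OpenUnit (x + 1ℚ)
shift-by-one x (0<-x , -x<1) =
    subst₂ _<_ (+-inverseˡ x) (+-comm 1ℚ x) (+-monoˡ-< x -x<1)
  , subst₂ _<_ (+-identityʳ (x + 1ℚ)) (solve 2 (λ x o → (x :+ o) :+ :- x := o) refl x 1ℚ)
               (+-monoʳ-< (x + 1ℚ) 0<-x)

unit-gap : ∀ {y z} → OpenUnit y → ClosedUnit z → OpenInterval (z - y)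
unit-gap {y} {z} (0<y , y<1) (0≤z , z≤1) =
    subst₂ _<_ (solve 2 (λ y o → y :+ (:- o :+ :- y) := :- o) refl y 1ℚ)
               (solve 3 (λ y z o → (o :+ z) :+ (:- o :+ :- y) := z :+ :- y) refl y z 1ℚ)
               (+-monoˡ-< (- 1ℚ + - y) (subst (_< 1ℚ + z) (+-identityʳ y) (+-mono-<-≤ y<1 0≤z)))
  , subst₂ _<_ (cong (_- y) (+-identityʳ z))
               (solve 2 (λ y o → (o :+ y) :+ :- y := o) refl y 1ℚ)
               (+-monoˡ-< (- y) (+-mono-≤-< z≤1 0<y))

difference-zero : ∀ {a b} → a - b ≡ 0ℚ → a ≡ b
difference-zero {a} {b} a-b≡0 = begin
  a            ≡⟨ solve 2 (λ a b → a := (a :+ :- b) :+ b) refl a b ⟩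
  (a - b) + b  ≡⟨ cong (_+ b) a-b≡0 ⟩
  0ℚ + b       ≡⟨ +-identityˡ b ⟩
  b            ∎
  where open ≡-Reasoning

-- The bilinear form of a Euclidean structure, and orthogonal reflections.

module Form {n : ℕ} (E : Euclidean n) where
  open Euclidean E

  ip-cong : ∀ {u u′ v v′} → u ≐ u′ → v ≐ v′ → ⟪ u , v ⟫ ≡ ⟪ u′ , v′ ⟫
  ip-cong eu ev = sumF-cong (λ i → sumF-cong (λ j → cong₂ (λ a b → a * G i j * b) (eu i) (ev j)))

  ip-congʳ : ∀ u {v v′} → v ≐ v′ → ⟪ u , v ⟫ ≡ ⟪ u , v′ ⟫
  ip-congʳ u = ip-cong {u} {u} (λ _ → refl)

  ip-sym : ∀ u v → ⟪ u , v ⟫ ≡ ⟪ v , u ⟫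
  ip-sym u v = trans (sumF-swap (λ i j → u i * G i j * v j))
    (sumF-cong (λ j → sumF-cong (λ i → trans (cong (λ g → u i * g * v j) (G-sym i j))
      (solve 3 (λ a g b → a :* g :* b := b :* g :* a) refl (u i) (G j i) (v j)))))

  ip-0ˡ : ∀ v → ⟪ zeroV , v ⟫ ≡ 0ℚ
  ip-0ˡ v = sumF-vanish _ (λ i → sumF-vanish _ (λ j →
    trans (cong (_* v j) (*-zeroˡ (G i j))) (*-zeroˡ (v j))))

  ip-+ˡ : ∀ u u′ v → ⟪ u ⊕ u′ , v ⟫ ≡ ⟪ u , v ⟫ + ⟪ u′ , v ⟫
  ip-+ˡ u u′ v = trans (sumF-cong (λ i → trans (sumF-cong (λ j →
      solve 4 (λ a a′ g b → (a :+ a′) :* g :* b := a :* g :* b :+ a′ :* g :* b) refl (u i) (u′ i) (G i j) (v j)))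
      (sumF-+ (λ j → u i * G i j * v j) (λ j → u′ i * G i j * v j))))
    (sumF-+ (λ i → sumF (λ j → u i * G i j * v j)) (λ i → sumF (λ j → u′ i * G i j * v j)))

  ip-*ˡ : ∀ c u v → ⟪ c • u , v ⟫ ≡ c * ⟪ u , v ⟫
  ip-*ˡ c u v = trans (sumF-cong (λ i → trans (sumF-cong (λ j →
      solve 4 (λ c a g b → (c :* a) :* g :* b := c :* (a :* g :* b)) refl c (u i) (G i j) (v j)))
      (sumF-* c (λ j → u i * G i j * v j))))
    (sumF-* c (λ i → sumF (λ j → u i * G i j * v j)))

  ip-negˡ : ∀ u v → ⟪ ⊖ u , v ⟫ ≡ - ⟪ u , v ⟫
  ip-negˡ u v = begin
    ⟪ ⊖ u , v ⟫            ≡⟨ ip-cong {⊖ u} {(- 1ℚ) • u} {v} (λ i → minus-one (u i)) (λ _ → refl) ⟩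
    ⟪ (- 1ℚ) • u , v ⟫     ≡⟨ ip-*ˡ (- 1ℚ) u v ⟩
    - 1ℚ * ⟪ u , v ⟫       ≡⟨ sym (minus-one ⟪ u , v ⟫) ⟩
    - ⟪ u , v ⟫            ∎
    where
    open ≡-Reasoning
    minus-one : ∀ x → - x ≡ - 1ℚ * x
    minus-one = solve 1 (λ x → :- x := :- con 1ℚ :* x) refl

  ip-negʳ : ∀ u v → ⟪ u , ⊖ v ⟫ ≡ - ⟪ u , v ⟫
  ip-negʳ u v = trans (ip-sym u (⊖ v)) (trans (ip-negˡ v u) (cong -_ (ip-sym v u)))

  ip-lincombˡ : ∀ {k} (c : Fin k → ℚ) (w : Fin k → Vect n) v →
                ⟪ lincomb c w , v ⟫ ≡ sumF (λ l → c l * ⟪ w l , v ⟫)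
  ip-lincombˡ {zero}  c w v = ip-0ˡ v
  ip-lincombˡ {suc k} c w v =
    trans (ip-+ˡ (c zero • w zero) (lincomb (λ l → c (suc l)) (λ l → w (suc l))) v)
          (cong₂ _+_ (ip-*ˡ (c zero) (w zero) v) (ip-lincombˡ (λ l → c (suc l)) (λ l → w (suc l)) v))

  ip-lincombʳ : ∀ {k} (c : Fin k → ℚ) (w : Fin k → Vect n) v →
                ⟪ v , lincomb c w ⟫ ≡ sumF (λ l → c l * ⟪ v , w l ⟫)
  ip-lincombʳ c w v =
    trans (ip-sym v (lincomb c w)) (trans (ip-lincombˡ c w v) (sumF-cong (λ l → cong (c l *_) (ip-sym (w l) v))))

  isotropic⇒zero : ∀ u → ⟪ u , u ⟫ ≡ 0ℚ → u ≐ zeroV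
  isotropic⇒zero u uu≡0 with all? (λ i → u i Q.≟ 0ℚ)
  ... | yes u≐0 = u≐0
  ... | no  u≉0 = ⊥-elim (<-irrefl (sym uu≡0) (G-posdef u u≉0))

  coroot : Vect n → Vect n → ℚ
  coroot a v = (1ℚ + 1ℚ) * ⟪ v , a ⟫ * inv ⟪ a , a ⟫

  ip-reflectˡ : ∀ a u v → ⟪ reflect a u , v ⟫ ≡ ⟪ u , v ⟫ - coroot a u * ⟪ a , v ⟫
  ip-reflectˡ a u v =
    trans (ip-+ˡ u (⊖ (coroot a u • a)) v)
          (cong (⟪ u , v ⟫ +_) (trans (ip-negˡ (coroot a u • a) v) (cong -_ (ip-*ˡ (coroot a u) a v))))

  reflect-adjoint : ∀ a u v → ⟪ reflect a u , v ⟫ ≡ ⟪ u , reflect a v ⟫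
  reflect-adjoint a u v = begin
    ⟪ reflect a u , v ⟫                                              ≡⟨ ip-reflectˡ a u v ⟩
    ⟪ u , v ⟫ - (1ℚ + 1ℚ) * ⟪ u , a ⟫ * inv ⟪ a , a ⟫ * ⟪ a , v ⟫  ≡⟨ cong₂ (λ p q → p - (1ℚ + 1ℚ) * q * inv ⟪ a , a ⟫ * ⟪ a , v ⟫) (ip-sym u v) (ip-sym u a) ⟩
    ⟪ v , u ⟫ - (1ℚ + 1ℚ) * ⟪ a , u ⟫ * inv ⟪ a , a ⟫ * ⟪ a , v ⟫  ≡⟨ cong (λ t → ⟪ v , u ⟫ - t) (solve 4 (λ t p i q → t :* p :* i :* q := t :* q :* i :* p) refl (1ℚ + 1ℚ) ⟪ a , u ⟫ (inv ⟪ a , a ⟫) ⟪ a , v ⟫) ⟩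
    ⟪ v , u ⟫ - (1ℚ + 1ℚ) * ⟪ a , v ⟫ * inv ⟪ a , a ⟫ * ⟪ a , u ⟫  ≡⟨ cong (λ q → ⟪ v , u ⟫ - (1ℚ + 1ℚ) * q * inv ⟪ a , a ⟫ * ⟪ a , u ⟫) (ip-sym a v) ⟩
    ⟪ v , u ⟫ - coroot a v * ⟪ a , u ⟫                              ≡⟨ sym (ip-reflectˡ a v u) ⟩
    ⟪ reflect a v , u ⟫                                              ≡⟨ ip-sym (reflect a v) u ⟩
    ⟪ u , reflect a v ⟫                                              ∎
    where open ≡-Reasoning

  reflect-cong : ∀ {a a′ v v′} → a ≐ a′ → v ≐ v′ → reflect a v ≐ reflect a′ v′
  reflect-cong ea ev i = cong₂ (λ x y → x - y) (ev i)
    (cong₂ _*_ (cong₂ (λ p q → (1ℚ + 1ℚ) * p * inv q) (ip-cong ev ea) (ip-cong ea ea)) (ea i))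

  inv-inverse : ∀ q → q ≢ 0ℚ → q * inv q ≡ 1ℚ
  inv-inverse q q≢0 with q Q.≟ 0ℚ
  ... | yes q≡0  = ⊥-elim (q≢0 q≡0)
  ... | no  q≢0′ = *-inverseʳ q {{≢-nonZero q≢0′}}

  reflect-self : ∀ a → ¬ (a ≐ zeroV) → reflect a a ≐ (⊖ a)
  reflect-self a a≢0 i = begin
    a i - (1ℚ + 1ℚ) * ⟪ a , a ⟫ * inv ⟪ a , a ⟫ * a i   ≡⟨ cong (λ t → a i - t * a i) two ⟩
    a i - (1ℚ + 1ℚ) * a i                              ≡⟨ solve 1 (λ x → x :+ :- ((con 1ℚ :+ con 1ℚ) :* x) := :- x) refl (a i) ⟩
    - a i                                              ∎
    where
    open ≡-Reasoning
    aa≢0 : ⟪ a , a ⟫ ≢ 0ℚ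
    aa≢0 aa≡0 = a≢0 (isotropic⇒zero a aa≡0)
    two : (1ℚ + 1ℚ) * ⟪ a , a ⟫ * inv ⟪ a , a ⟫ ≡ 1ℚ + 1ℚ
    two = trans (*-assoc (1ℚ + 1ℚ) ⟪ a , a ⟫ (inv ⟪ a , a ⟫))
                (trans (cong ((1ℚ + 1ℚ) *_) (inv-inverse ⟪ a , a ⟫ aa≢0)) (*-identityʳ (1ℚ + 1ℚ)))

-- Roots, the Weyl group action and the fundamental alcove.

module Roots {r : ℕ} (Φ : RootSystem r) where
  open RootSystem Φ
  open Form E

  act-++ : ∀ xs ys v → act (xs ++ ys) v ≡ act xs (act ys v)
  act-++ []       ys v = refl
  act-++ (a ∷ xs) ys v = cong (reflect (root a)) (act-++ xs ys v)

  actInv-adjoint : ∀ w μ v → ⟪ actInv w μ , v ⟫ ≡ ⟪ μ , act w v ⟫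
  actInv-adjoint []      μ v = refl
  actInv-adjoint (a ∷ w) μ v = begin
    ⟪ actInv (a ∷ w) μ , v ⟫               ≡⟨ cong (λ z → ⟪ z , v ⟫) unfold ⟩
    ⟪ actInv w (reflect (root a) μ) , v ⟫  ≡⟨ actInv-adjoint w (reflect (root a) μ) v ⟩
    ⟪ reflect (root a) μ , act w v ⟫       ≡⟨ reflect-adjoint (root a) μ (act w v) ⟩
    ⟪ μ , act (a ∷ w) v ⟫                  ∎
    where
    open ≡-Reasoning
    unfold : actInv (a ∷ w) μ ≡ actInv w (reflect (root a) μ)
    unfold = trans (cong (λ l → act l μ) (unfold-reverse a w)) (act-++ (reverse w) (a ∷ []) μ)

  IsRoot : Vect r → Set
  IsRoot v = Σ (Fin m) λ a → root a ≐ v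

  act-root : ∀ w {v} → IsRoot v → IsRoot (act w v)
  act-root []      β = β
  act-root (a ∷ w) β with act-root w β
  ... | c , e with refl-closed a c
  ... | b , e′ = b , λ i → trans (e′ i) (reflect-cong {root a} {root a} (λ _ → refl) e i)

  neg-root : ∀ {v} → IsRoot v → IsRoot (⊖ v)
  neg-root (a , e) with refl-closed a a
  ... | b , e′ = b , λ i → trans (e′ i) (trans (reflect-self (root a) (root≢0 a) i) (cong -_ (e i)))

  root-sign : ∀ {v} → IsRoot v → Positive v ⊎ Negative v
  root-sign (a , e) with base a
  ... | c , inj₁ p = inj₁ (a , e , c , λ i → trans (sym (e i)) (p i))
  ... | c , inj₂ p with neg-root (a , e)
  ...   | b , e′ = inj₂ (b , e′ , c , λ i → trans (cong -_ (trans (sym (e i)) (p i))) (⁻¹-involutive _))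

  alcove-positive : ∀ {μ v} → InAlcove μ → Positive v → OpenUnit ⟪ μ , v ⟫
  alcove-positive {μ} A (a , e , c , p) with A a (a , (λ _ → refl) , c , λ i → trans (e i) (p i))
  ... | lo , hi = subst (0ℚ <_) (ip-congʳ μ e) lo , subst (_< 1ℚ) (ip-congʳ μ e) hi

  alcove-negative : ∀ {μ v} → InAlcove μ → Negative v → OpenUnit (- ⟪ μ , v ⟫)
  alcove-negative {μ} {v} A N with alcove-positive {μ} {⊖ v} A N
  ... | lo , hi = subst (0ℚ <_) (ip-negʳ μ v) lo , subst (_< 1ℚ) (ip-negʳ μ v) hi

  ℕ-coeffs : (Fin r → ℕ) → Fin r → ℚ
  ℕ-coeffs c i = Z.+ c i / 1

  simpleSum : Vect r → (Fin r → ℕ) → ℚ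
  simpleSum v c = sumF (λ i → ℕ-coeffs c i * ⟪ v , α i ⟫)

  ip-root : ∀ v a → Σ (Fin r → ℕ) λ c → (⟪ v , root a ⟫ ≡ simpleSum v c) ⊎ (⟪ v , root a ⟫ ≡ - simpleSum v c)
  ip-root v a with base a
  ... | c , inj₁ p = c , inj₁ (trans (ip-congʳ v p) (ip-lincombʳ (ℕ-coeffs c) α v))
  ... | c , inj₂ p = c , inj₂ (trans (ip-congʳ v p)
                                (trans (ip-negʳ v (lincomb (ℕ-coeffs c) α)) (cong -_ (ip-lincombʳ (ℕ-coeffs c) α v))))

  coweight-from-simple : ∀ λ′ → (∀ i → Integral ⟪ λ′ , α i ⟫) → Coweight λ′
  coweight-from-simple λ′ h a = Integral⇒IsInt (signed (ip-root λ′ a))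
    where
    sum-integral : ∀ c → Integral (simpleSum λ′ c)
    sum-integral c = integral-sumF _ (λ i → integral-* (integral-ℕ (c i)) (h i))
    signed : (Σ (Fin r → ℕ) λ c → (⟪ λ′ , root a ⟫ ≡ simpleSum λ′ c) ⊎ (⟪ λ′ , root a ⟫ ≡ - simpleSum λ′ c)) →
             Integral ⟪ λ′ , root a ⟫
    signed (c , inj₁ e) = subst Integral (sym e) (sum-integral c)
    signed (c , inj₂ e) = subst Integral (sym e) (integral-neg (sum-integral c))

  -- a vector orthogonal to all simple roots is orthogonal to Φ, hence to V
  -- (Φ spans V), hence zero
  orthogonal-to-simple : ∀ u → (∀ i → ⟪ u , α i ⟫ ≡ 0ℚ) → u ≐ zeroV
  orthogonal-to-simple u h = isotropic⇒zero u (begin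
    ⟪ u , u ⟫                               ≡⟨ ip-congʳ u (proj₂ (spans u)) ⟩
    ⟪ u , lincomb c root ⟫                  ≡⟨ ip-lincombʳ c root u ⟩
    sumF (λ a → c a * ⟪ u , root a ⟫)      ≡⟨ sumF-vanish _ (λ a → trans (cong (c a *_) (⊥root a)) (*-zeroʳ (c a))) ⟩
    0ℚ                                      ∎)
    where
    open ≡-Reasoning
    c : Fin m → ℚ
    c = proj₁ (spans u)
    sum-zero : ∀ c′ → simpleSum u c′ ≡ 0ℚ
    sum-zero c′ = sumF-vanish _ (λ i → trans (cong (ℕ-coeffs c′ i *_) (h i)) (*-zeroʳ (ℕ-coeffs c′ i)))
    ⊥root : ∀ a → ⟪ u , root a ⟫ ≡ 0ℚ
    ⊥root a with ip-root u a
    ... | c′ , inj₁ e = trans e (sum-zero c′)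
    ... | c′ , inj₂ e = trans e (cong -_ (sum-zero c′))

-- Fundamental coweights, and a point of the fundamental alcove.

module Coweights {r : ℕ} (Φ : RootSystem r) (ω : Fin r → Vect r) (fund : RootSystem.IsFundCoweights Φ ω) where
  open RootSystem Φ
  open Form E
  open Roots Φ

  ip-coweight-simple : ∀ (d : Fin r → ℚ) j → ⟪ lincomb d ω , α j ⟫ ≡ d j
  ip-coweight-simple d j = begin
    ⟪ lincomb d ω , α j ⟫              ≡⟨ ip-lincombˡ d ω (α j) ⟩
    sumF (λ k → d k * ⟪ ω k , α j ⟫)  ≡⟨ sumF-single _ j (λ k k≢j → trans (cong (d k *_) (proj₂ (fund k j) k≢j)) (*-zeroʳ (d k))) ⟩
    d j * ⟪ ω j , α j ⟫                ≡⟨ cong (d j *_) (proj₁ (fund j j) refl) ⟩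
    d j * 1ℚ                           ≡⟨ *-identityʳ (d j) ⟩
    d j                                ∎
    where open ≡-Reasoning

  ρ : Vect r
  ρ = lincomb (λ _ → 1ℚ) ω

  height : Fin m → ℚ
  height a = ⟪ ρ , root a ⟫

  height-coeffs : ∀ a (c : Fin r → ℕ) → root a ≐ lincomb (ℕ-coeffs c) α → height a ≡ sumF (ℕ-coeffs c)
  height-coeffs a c p = begin
    ⟪ ρ , root a ⟫                                ≡⟨ ip-congʳ ρ p ⟩
    ⟪ ρ , lincomb (ℕ-coeffs c) α ⟫               ≡⟨ ip-lincombʳ (ℕ-coeffs c) α ρ ⟩
    sumF (λ i → ℕ-coeffs c i * ⟪ ρ , α i ⟫)     ≡⟨ sumF-cong (λ i → trans (cong (ℕ-coeffs c i *_) (ip-coweight-simple _ i)) (*-identityʳ _)) ⟩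
    sumF (ℕ-coeffs c)                             ∎
    where open ≡-Reasoning

  -- positive roots have height at least 1: some coefficient is nonzero
  -- since roots are nonzero
  height-positive : ∀ a → Positive (root a) → 1ℚ ≤ height a
  height-positive a (_ , _ , c , p) with any? (λ i → 1 N.≤? c i)
  ... | yes (i , 1≤cᵢ) = subst (1ℚ ≤_) (sym (height-coeffs a c p))
                           (≤-trans (1≤ℕ (c i) 1≤cᵢ) (sumF-term (ℕ-coeffs c) (λ j → 0≤ℕ (c j)) i))
  ... | no  all-zero   = ⊥-elim (root≢0 a (λ j → trans (p j) (sumF-vanish _ (λ i → vanish i j))))
    where
    vanish : ∀ i j → ℕ-coeffs c i * α i j ≡ 0ℚ
    vanish i j rewrite NP.n<1⇒n≡0 (NP.≰⇒> (λ 1≤cᵢ → all-zero (i , 1≤cᵢ))) = *-zeroˡ (α i j)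

  -- H = 1 + Σ_β |ht β| exceeds the height of every positive root
  H : ℚ
  H = 1ℚ + sumF (λ a → ∣ height a ∣)

  height<H : ∀ a → Positive (root a) → height a < H
  height<H a P = begin-strict
    height a                       ≡⟨ sym (0≤p⇒∣p∣≡p (≤-trans (<⇒≤ 0<1) (height-positive a P))) ⟩
    ∣ height a ∣                   ≤⟨ sumF-term (λ b → ∣ height b ∣) (λ b → 0≤∣p∣ (height b)) a ⟩
    sumF (λ b → ∣ height b ∣)      <⟨ subst (_< H) (+-identityˡ _) (+-monoˡ-< (sumF (λ b → ∣ height b ∣)) 0<1) ⟩
    H                              ∎
    where open ≤-Reasoning

  H-positive : Q.Positive H
  H-positive = Q.positive (<-≤-trans 0<1 (subst (_≤ H) (+-identityʳ 1ℚ)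
                 (+-monoʳ-≤ 1ℚ (sumF-nonneg _ (λ b → 0≤∣p∣ (height b))))))

  H⁻¹ : ℚ
  H⁻¹ = (1/ H) {{pos⇒nonZero H {{H-positive}}}}

  μ₀ : Vect r
  μ₀ = H⁻¹ • ρ

  μ₀-alcove : InAlcove μ₀
  μ₀-alcove a P = subst (0ℚ <_) (sym μ₀-height) lower , subst (_< 1ℚ) (sym μ₀-height) upper
    where
    instance
      H⁻¹-positive : Q.Positive H⁻¹
      H⁻¹-positive = 1/pos⇒pos H {{H-positive}}
    μ₀-height : ⟪ μ₀ , root a ⟫ ≡ H⁻¹ * height a
    μ₀-height = ip-*ˡ H⁻¹ ρ (root a)
    lower : 0ℚ < H⁻¹ * height a
    lower = subst (_< H⁻¹ * height a) (*-zeroʳ H⁻¹) (*-monoʳ-<-pos H⁻¹ (<-≤-trans 0<1 (height-positive a P)))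
    upper : H⁻¹ * height a < 1ℚ
    upper = subst (H⁻¹ * height a <_) (*-inverseˡ H {{pos⇒nonZero H {{H-positive}}}}) (*-monoʳ-<-pos H⁻¹ (height<H a P))

-- The descent window, existence and uniqueness of δ_w.

module Descent {r : ℕ} (Φ : RootSystem r) (ω : Fin r → Vect r) (fund : RootSystem.IsFundCoweights Φ ω)
               (w : RootSystem.Word Φ) (d : Fin r → ℚ) (desc : RootSystem.IsDescent Φ w d) where
  open RootSystem Φ
  open Form E
  open Roots Φ
  open Coweights Φ ω fund

  δ : Vect r
  δ = delta d ω

  descent-integral : ∀ i → Integral (d i)
  descent-integral i with desc i
  ... | inj₁ (d≡1 , _) = Z.+ 1 , d≡1
  ... | inj₂ (d≡0 , _) = +0 , d≡0

  -- for μ ∈ A∘, ⟪μ , w α_i⟫ lies in (-1,0) if w α_i < 0 and in (0,1)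
  -- otherwise; adding d_i(w) moves it into (0,1) in both cases
  descent-window : ∀ {μ} → InAlcove μ → ∀ i → OpenUnit (⟪ μ , act w (α i) ⟫ + d i)
  descent-window {μ} A i with desc i
  ... | inj₁ (d≡1 , N) = subst (λ t → OpenUnit (x + t)) (sym d≡1) (shift-by-one x (alcove-negative {μ} {act w (α i)} A N))
    where x = ⟪ μ , act w (α i) ⟫
  ... | inj₂ (d≡0 , ¬N) = subst OpenUnit (sym (trans (cong (x +_) d≡0) (+-identityʳ x)))
                            (alcove-positive {μ} {act w (α i)} A positive)
    where
    x = ⟪ μ , act w (α i) ⟫
    positive : Positive (act w (α i))
    positive with root-sign (act-root w (simple i , λ _ → refl))
    ... | inj₁ P = P
    ... | inj₂ N = ⊥-elim (¬N N)

  ip-translate : ∀ μ λ′ i → ⟪ actInv w μ ⊕ λ′ , α i ⟫ ≡ ⟪ μ , act w (α i) ⟫ + ⟪ λ′ , α i ⟫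
  ip-translate μ λ′ i = trans (ip-+ˡ (actInv w μ) λ′ (α i)) (cong (_+ ⟪ λ′ , α i ⟫) (actInv-adjoint w μ (α i)))

  δ-coweight : Coweight δ
  δ-coweight = coweight-from-simple δ (λ i → subst Integral (sym (ip-coweight-simple d i)) (descent-integral i))

  δ-translate : Translate⊆Π w δ
  δ-translate μ A i = subst ClosedUnit (sym pairing) (open⊆closed (descent-window {μ} A i))
    where
    pairing : ⟪ actInv w μ ⊕ δ , α i ⟫ ≡ ⟪ μ , act w (α i) ⟫ + d i
    pairing = trans (ip-translate μ δ i) (cong (⟪ μ , act w (α i) ⟫ +_) (ip-coweight-simple d i))

  -- any coweight λ with w⁻¹(A∘) + λ ⊆ Π has ⟪λ , α_i⟫ = d_i(w): the
  -- integer ⟪λ , α_i⟫ - d_i(w) is a difference of a number in [0,1]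
  -- (test at μ₀) and one in (0,1) (descent window at μ₀)
  pinned : ∀ λ′ → Coweight λ′ → Translate⊆Π w λ′ → ∀ i → ⟪ λ′ , α i ⟫ ≡ d i
  pinned λ′ cw tr i = difference-zero (integral-between integral gap′)
    where
    x L : ℚ
    x = ⟪ μ₀ , act w (α i) ⟫
    L = ⟪ λ′ , α i ⟫
    gap : OpenInterval (x + L - (x + d i))
    gap = unit-gap (descent-window {μ₀} μ₀-alcove i) (subst ClosedUnit (ip-translate μ₀ λ′ i) (tr μ₀ μ₀-alcove i))
    gap′ : OpenInterval (L - d i)
    gap′ = subst OpenInterval (solve 3 (λ x l e → x :+ l :+ :- (x :+ e) := l :+ :- e) refl x L (d i)) gap
    integral : Integral (L - d i)
    integral = integral-+ (IsInt⇒Integral (cw (simple i))) (integral-neg (descent-integral i))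

  -- λ - δ_w is orthogonal to every simple root, hence zero
  δ-unique : ∀ λ′ → Coweight λ′ → Translate⊆Π w λ′ → λ′ ≐ δ
  δ-unique λ′ cw tr i = difference-zero (orthogonal-to-simple (λ′ ⊕ (⊖ δ)) orthogonal i)
    where
    orthogonal : ∀ j → ⟪ λ′ ⊕ (⊖ δ) , α j ⟫ ≡ 0ℚ
    orthogonal j = begin
      ⟪ λ′ ⊕ (⊖ δ) , α j ⟫          ≡⟨ ip-+ˡ λ′ (⊖ δ) (α j) ⟩
      ⟪ λ′ , α j ⟫ + ⟪ ⊖ δ , α j ⟫  ≡⟨ cong₂ _+_ (pinned λ′ cw tr j) (trans (ip-negˡ δ (α j)) (cong -_ (ip-coweight-simple d j))) ⟩
      d j - d j                     ≡⟨ +-inverseʳ (d j) ⟩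
      0ℚ                            ∎
      where open ≡-Reasoning

mainTheorem13 : ∀ {r : ℕ} (Φ : RootSystem r) → let open RootSystem Φ in
    ∀ (ω : Fin r → Vect r) → IsFundCoweights ω →
    ∀ (w : Word) (d : Fin r → ℚ) → IsDescent w d →
    (Coweight (delta d ω) × Translate⊆Π w (delta d ω))
    × (∀ (λ' : Vect r) → Coweight λ' → Translate⊆Π w λ' → λ' ≐ delta d ω)
mainTheorem13 Φ ω fund w d desc = (δ-coweight , δ-translate) , δ-unique
  where open Descent Φ ω fund w d desc
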